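{- Let $\alpha\in\mathcal{E}$, let $R$ be a natural number, and let $x_0<\dots<x_R$ and $y_0<\dots<y_R$ be natural numbers with $\mathrm{MC}(\alpha)<y_0$ and $0<x_i\leq y_i$ for all $i\leq R$. If $\alpha[x_0][x_1]\dots[x_R]>0$, then $\alpha[y_0][y_1]\dots[y_R]>0$.
   Context: $\mathcal{E}$ is the set of notations for ordinals below $\varepsilon_0$: for $\alpha_0\geq\dots\geq\alpha_n$ in $\mathcal{E}$, the sum $\omega^{\alpha_0}+\dots+\omega^{\alpha_n}$ is in $\mathcal{E}$, and the empty sum is $0$. These notations are ordered lexicographically in the usual way, with $1=\omega^0$. A nonzero $\alpha=\omega^{\alpha_0}+\dots+\omega^{\alpha_n}$ is a successor if $\alpha_n=0$ and a limit otherwise. Maximal coefficient: $\mathrm{MC}(0)=0$, and if $\alpha$ has Cantor normal form $\omega^{\alpha_0}a_0+\dots+\omega^{\alpha_n}a_n$ (with $\alpha_0>\dots>\alpha_n$ and positive integers $a_i$), then $\mathrm{MC}(\alpha)=\max_i\{a_i,\mathrm{MC}(\alpha_i)\}$. Fundamental sequences: $0[x]=0$ and $(\alpha+1)[x]=\alpha$. For $\alpha=\omega^{\alpha_0}+\dots+\omega^{\alpha_n}$: if $\alpha_n=\beta+1$, then $\alpha[x]=\omega^{\alpha_0}+\dots+\omega^{\alpha_{n-1}}+\omega^{\beta}\cdot x$; if $\alpha_n$ is a limit, then $\alpha[x]=\omega^{\alpha_0}+\dots+\omega^{\alpha_{n-1}}+\omega^{\alpha_n[x]}$. The expression $\alpha[x_0]\dots[x_R]$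 denotes iterated application, $(\dots((\alpha[x_0])[x_1])\dots)[x_R]$. -}

module Defs where

open import Data.Nat using (ℕ; zero; suc; _⊔_)
open import Data.Bool using (Bool; true; false; if_then_else_)
open import Data.Fin using (Fin) renaming (zero to fzero; suc to fsuc)
open import Relation.Binary.PropositionalEquality using (_≡_; refl)
open import Data.Sum using (_⊎_)
open import Relation.Nullary using (Dec; yes; no; does)

data T : Set where
  zer : T
  ω^_+_ : T → T → T

data _<ₒ_ : T → T → Set where
  z<ω : ∀ {a b} → zer <ₒ (ω^ a + b)
  exp< : ∀ {a b c d} → a <ₒ c → (ω^ a + b) <ₒ (ω^ c + d)
  tail< : ∀ {a b d} → b <ₒ d → (ω^ a + b) <ₒ (ω^ a + d)

_≤ₒ_ : T → T → Set
a ≤ₒ b = (a <ₒ b) ⊎ (a ≡ b)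

-- Membership in ℰ: exponents nonincreasing (recursively).
data NF : T → Set where
  nf0 : NF zer
  nf1 : ∀ {a} → NF a → NF (ω^ a + zer)
  nf2 : ∀ {a c d} → NF a → c ≤ₒ a → NF (ω^ c + d) → NF (ω^ a + (ω^ c + d))

_≟ₒ_ : (a b : T) → Dec (a ≡ b)
zer ≟ₒ zer = yes refl
zer ≟ₒ (ω^ _ + _) = no (λ ())
(ω^ _ + _) ≟ₒ zer = no (λ ())
(ω^ a + b) ≟ₒ (ω^ c + d) with a ≟ₒ c | b ≟ₒ d
... | yes refl | yes refl = yes refl
... | no p | _ = no (λ { refl → p refl })
... | yes _ | no q = no (λ { refl → q refl })

lead : T → T → ℕ
lead a zer = 1
lead a (ω^ c + d) = if does (a ≟ₒ c) then suc (lead a d) else 1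

-- Maximal coefficient: max over all Cantor-normal-form coefficients
-- (maximal runs of equal exponents) and MC of the exponents.
MC : T → ℕ
MC zer = 0
MC (ω^ a + b) = MC a ⊔ MC b ⊔ lead a b

isSucc : T → Bool
isSucc zer = false
isSucc (ω^ zer + zer) = true
isSucc (ω^ (ω^ _ + _) + zer) = false
isSucc (ω^ _ + (ω^ c + d)) = isSucc (ω^ c + d)

ωmul : T → ℕ → T → T
ωmul e zero t = t
ωmul e (suc x) t = ω^ e + ωmul e x t

_[_] : T → ℕ → T
zer [ x ] = zer
(ω^ a + (ω^ c + d)) [ x ] = ω^ a + ((ω^ c + d) [ x ])
(ω^ zer + zer) [ x ] = zer
(ω^ (ω^ c + d) + zer) [ x ] =
  if isSucc (ω^ c + d)
  then ωmul ((ω^ c + d) [ x ]) x zer     -- exponent β+1: ω^β · x, β = (β+1)[x]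
  else ω^ ((ω^ c + d) [ x ]) + zer

iterFS : T → (n : ℕ) → (Fin n → ℕ) → T
iterFS α zero f = α
iterFS α (suc n) f = iterFS (α [ f fzero ]) n (λ i → f (fsuc i))

-- If γ <ₒ β and all coefficients of γ are below y > 0, then γ ≤ₒ β[y], with equality
-- only when β is a successor (the Bachmann property). Together with monotonicity of
-- α[x] in x this gives a[x] ≤ₒ b[y] whenever a ≤ₒ b, x ≤ y and MC a < y. The
-- coefficients of a[x] stay below max(MC a + 1, x + 1) ≤ y_{i+1}, so the invariant
-- "the x-chain is below the y-chain" propagates along α[x₀]…[x_R] and α[y₀]…[y_R];
-- a positive end of the first chain therefore bounds the second from below.
module Submission where

open import Defs
open import Data.Nat using (ℕ; zero; suc; _<_; _≤_; _⊔_; z≤n; s≤s)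
open import Data.Nat.Properties
open import Data.Fin using (Fin) renaming (_<_ to _<ᶠ_; zero to fzero; suc to fsuc)
open import Data.Bool using (true; false)
open import Data.Unit using (⊤; tt)
open import Data.Sum using (_⊎_; inj₁; inj₂)
open import Data.Product using (_×_; _,_)
open import Data.Empty using (⊥-elim)
open import Relation.Binary.PropositionalEquality hiding ([_])
open import Relation.Nullary using (¬_; yes; no; does)

<ₒ-trans : ∀ {a b c} → a <ₒ b → b <ₒ c → a <ₒ c
<ₒ-trans z<ω (exp< _) = z<ω
<ₒ-trans z<ω (tail< _) = z<ω
<ₒ-trans (exp< p) (exp< q) = exp< (<ₒ-trans p q)
<ₒ-trans (exp< p) (tail< q) = exp< p
<ₒ-trans (tail< p) (exp< q) = exp< q
<ₒ-trans (tail< p) (tail< q) = tail< (<ₒ-trans p q)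

<ₒ-irrefl : ∀ {a} → ¬ (a <ₒ a)
<ₒ-irrefl (exp< p) = <ₒ-irrefl p
<ₒ-irrefl (tail< p) = <ₒ-irrefl p

≤ₒ-<ₒ-trans : ∀ {a b c} → a ≤ₒ b → b <ₒ c → a <ₒ c
≤ₒ-<ₒ-trans (inj₁ p) q = <ₒ-trans p q
≤ₒ-<ₒ-trans (inj₂ refl) q = q

<ₒ-≤ₒ-trans : ∀ {a b c} → a <ₒ b → b ≤ₒ c → a <ₒ c
<ₒ-≤ₒ-trans p (inj₁ q) = <ₒ-trans p q
<ₒ-≤ₒ-trans p (inj₂ refl) = p

≤ₒ-trans : ∀ {a b c} → a ≤ₒ b → b ≤ₒ c → a ≤ₒ c
≤ₒ-trans p (inj₁ q) = inj₁ (≤ₒ-<ₒ-trans p q)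
≤ₒ-trans p (inj₂ refl) = p

NF-exponent : ∀ {a b} → NF (ω^ a + b) → NF a
NF-exponent (nf1 n) = n
NF-exponent (nf2 n _ _) = n

NF-tail : ∀ {a b} → NF (ω^ a + b) → NF b
NF-tail (nf1 _) = nf0
NF-tail (nf2 _ _ n) = n

ωmul<ω^ : ∀ {e b} → e <ₒ b → ∀ x → ωmul e x zer <ₒ (ω^ b + zer)
ωmul<ω^ p zero = z<ω
ωmul<ω^ p (suc x) = exp< p

[]<ₒ : ∀ a b x → NF (ω^ a + b) → ((ω^ a + b) [ x ]) <ₒ (ω^ a + b)
[]<ₒ a (ω^ c + d) x (nf2 _ _ n) = tail< ([]<ₒ c d x n)
[]<ₒ zer zer x _ = z<ω
[]<ₒ (ω^ c + d) zer x (nf1 n) with isSucc (ω^ c + d)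
... | true = ωmul<ω^ ([]<ₒ c d x n) x
... | false = exp< ([]<ₒ c d x n)

[]≤ₒ : ∀ a x → NF a → (a [ x ]) ≤ₒ a
[]≤ₒ zer x _ = inj₂ refl
[]≤ₒ (ω^ a + b) x n = inj₁ ([]<ₒ a b x n)

LeadingExponent : (T → Set) → T → Set
LeadingExponent P zer = ⊤
LeadingExponent P (ω^ c + _) = P c

NF-ω^+ : ∀ {a δ} → NF a → NF δ → LeadingExponent (_≤ₒ a) δ → NF (ω^ a + δ)
NF-ω^+ na nf0 _ = nf1 na
NF-ω^+ na n@(nf1 _) p = nf2 na p n
NF-ω^+ na n@(nf2 _ _ _) p = nf2 na p n

NF-ωmul : ∀ {e} x → NF e → NF (ωmul e x zer)
NF-ωmul zero ne = nf0
NF-ωmul (suc zero) ne = nf1 ne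
NF-ωmul (suc (suc k)) ne = nf2 ne (inj₂ refl) (NF-ωmul (suc k) ne)

leadingExponent-ωmul : ∀ {P e} x → P e → LeadingExponent P (ωmul e x zer)
leadingExponent-ωmul zero p = tt
leadingExponent-ωmul (suc x) p = p

leadingExponent-[]-monomial : ∀ E x → NF (ω^ E + zer)
  → LeadingExponent (_<ₒ E) ((ω^ E + zer) [ x ])
leadingExponent-[]-monomial zer x _ = tt
leadingExponent-[]-monomial (ω^ c + d) x (nf1 n) with isSucc (ω^ c + d)
... | true = leadingExponent-ωmul x ([]<ₒ c d x n)
... | false = []<ₒ c d x n

leadingExponent-[] : ∀ {a} δ x → NF δ → LeadingExponent (_≤ₒ a) δ
  → LeadingExponent (_≤ₒ a) (δ [ x ])
leadingExponent-[] zer x _ _ = tt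
leadingExponent-[] (ω^ c + (ω^ e + f)) x _ p = p
leadingExponent-[] {a} (ω^ E + zer) x n E≤a
  with (ω^ E + zer) [ x ] | leadingExponent-[]-monomial E x n
... | zer | _ = tt
... | ω^ c + _ | c<E = inj₁ (<ₒ-≤ₒ-trans c<E E≤a)

NF-[] : ∀ α x → NF α → NF (α [ x ])
NF-[] zer x n = n
NF-[] (ω^ a + (ω^ c + d)) x (nf2 na p nt) =
  NF-ω^+ na (NF-[] _ x nt) (leadingExponent-[] _ x nt p)
NF-[] (ω^ zer + zer) x _ = nf0
NF-[] (ω^ (ω^ c + d) + zer) x (nf1 n) with isSucc (ω^ c + d)
... | true = NF-ωmul x (NF-[] _ x n)
... | false = nf1 (NF-[] _ x n)

ωmul-mono : ∀ {e f x y} → e ≤ₒ f → x ≤ y → ωmul e x zer ≤ₒ ωmul f y zer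
ωmul-mono {x = zero} {zero} _ _ = inj₂ refl
ωmul-mono {x = zero} {suc y} _ _ = inj₁ z<ω
ωmul-mono {x = suc x} {suc y} (inj₁ e<f) _ = inj₁ (exp< e<f)
ωmul-mono {x = suc x} {suc y} (inj₂ refl) (s≤s x≤y) with ωmul-mono (inj₂ refl) x≤y
... | inj₁ q = inj₁ (tail< q)
... | inj₂ q = inj₂ (cong (ω^ _ +_) q)

[]-monoʳ : ∀ α {x y} → NF α → x ≤ y → (α [ x ]) ≤ₒ (α [ y ])
[]-monoʳ zer _ _ = inj₂ refl
[]-monoʳ (ω^ a + (ω^ c + d)) (nf2 _ _ n) x≤y with []-monoʳ (ω^ c + d) n x≤y
... | inj₁ q = inj₁ (tail< q)
... | inj₂ q = inj₂ (cong (ω^ a +_) q)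
[]-monoʳ (ω^ zer + zer) _ _ = inj₂ refl
[]-monoʳ (ω^ (ω^ c + d) + zer) (nf1 n) x≤y with isSucc (ω^ c + d)
... | true = ωmul-mono ([]-monoʳ (ω^ c + d) n x≤y) x≤y
... | false with []-monoʳ (ω^ c + d) n x≤y
...   | inj₁ q = inj₁ (exp< q)
...   | inj₂ q = inj₂ (cong (λ e → ω^ e + zer) q)

data CoeffsBelow (y : ℕ) : T → Set where
  zer : CoeffsBelow y zer
  ω^_+_∣_ : ∀ {c g} → CoeffsBelow y c → CoeffsBelow y g → lead c g < y
          → CoeffsBelow y (ω^ c + g)

MC<⇒coeffsBelow : ∀ α {y} → MC α < y → CoeffsBelow y α
MC<⇒coeffsBelow zer _ = zer
MC<⇒coeffsBelow (ω^ a + b) {y} mc =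
  ω^ MC<⇒coeffsBelow a (below (≤-trans (m≤m⊔n (MC a) (MC b)) (m≤m⊔n _ (lead a b))))
   + MC<⇒coeffsBelow b (below (≤-trans (m≤n⊔m (MC a) (MC b)) (m≤m⊔n _ (lead a b))))
   ∣ below (m≤n⊔m (MC a ⊔ MC b) (lead a b))
  where
    below : ∀ {n} → n ≤ MC (ω^ a + b) → n < y
    below n≤ = ≤-<-trans n≤ mc

coeffsBelow-mono : ∀ {y y' α} → y ≤ y' → CoeffsBelow y α → CoeffsBelow y' α
coeffsBelow-mono y≤y' zer = zer
coeffsBelow-mono y≤y' (ω^ bc + bg ∣ l) =
  ω^ coeffsBelow-mono y≤y' bc + coeffsBelow-mono y≤y' bg ∣ <-≤-trans l y≤y'

lead-positive : ∀ a g → 1 ≤ lead a g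
lead-positive a zer = ≤-refl
lead-positive a (ω^ c + d) with does (a ≟ₒ c)
... | true = s≤s z≤n
... | false = ≤-refl

lead-ωmul : ∀ e k → lead e (ωmul e k zer) ≡ suc k
lead-ωmul e zero = refl
lead-ωmul e (suc k) with e ≟ₒ e
... | yes _ = cong suc (lead-ωmul e k)
... | no e≢e = ⊥-elim (e≢e refl)

lead≤1 : ∀ a δ → LeadingExponent (_<ₒ a) δ → lead a δ ≤ 1
lead≤1 a zer _ = ≤-refl
lead≤1 a (ω^ c + d) c<a with a ≟ₒ c
... | yes refl = ⊥-elim (<ₒ-irrefl c<a)
... | no _ = ≤-refl

lead-[] : ∀ a δ x → NF (ω^ a + δ) → lead a (δ [ x ]) ≤ lead a δ
lead-[] a zer x _ = ≤-refl
lead-[] a (ω^ c + (ω^ e + f)) x (nf2 _ _ n) with a ≟ₒ c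
... | yes refl = s≤s (lead-[] c (ω^ e + f) x n)
... | no _ = ≤-refl
lead-[] a (ω^ E + zer) x (nf2 _ E≤a n) with (ω^ E + zer) [ x ] | leadingExponent-[]-monomial E x n
... | zer | _ = lead-positive a (ω^ E + zer)
... | ω^ c + d | c<E =
  ≤-trans (lead≤1 a (ω^ c + d) (<ₒ-≤ₒ-trans c<E E≤a)) (lead-positive a (ω^ E + zer))

coeffsBelow-ωmul : ∀ {e y} → CoeffsBelow y e → ∀ k → k < y → CoeffsBelow y (ωmul e k zer)
coeffsBelow-ωmul be zero _ = zer
coeffsBelow-ωmul {e} {y} be (suc k) k<y =
  ω^ be + coeffsBelow-ωmul be k (<-trans (n<1+n k) k<y) ∣ subst (_< y) (sym (lead-ωmul e k)) k<y

coeffsBelow-[] : ∀ α x {y} → NF α → CoeffsBelow y α → x < y → CoeffsBelow y (α [ x ])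
coeffsBelow-[] zer x _ _ _ = zer
coeffsBelow-[] (ω^ a + (ω^ c + d)) x n@(nf2 _ _ nt) (ω^ ba + bt ∣ l) x<y =
  ω^ ba + coeffsBelow-[] _ x nt bt x<y ∣ ≤-<-trans (lead-[] a (ω^ c + d) x n) l
coeffsBelow-[] (ω^ zer + zer) x _ _ _ = zer
coeffsBelow-[] (ω^ (ω^ c + d) + zer) x (nf1 n) (ω^ bE + _ ∣ l) x<y with isSucc (ω^ c + d)
... | true = coeffsBelow-ωmul (coeffsBelow-[] _ x n bE x<y) x x<y
... | false = ω^ coeffsBelow-[] _ x n bE x<y + zer ∣ l

ω^+<ₒωmul : ∀ {e c h y} → e <ₒ c → 0 < y → (ω^ e + h) <ₒ ωmul c y zer
ω^+<ₒωmul e<c (s≤s z≤n) = exp< e<c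

run<ₒωmul : ∀ {c g y} → NF (ω^ c + g) → lead c g < y → (ω^ c + g) <ₒ ωmul c y zer
run<ₒωmul {c} {zer} {suc (suc y)} _ _ = tail< z<ω
run<ₒωmul {c} {zer} {suc zero} _ (s≤s ())
run<ₒωmul {c} {ω^ e + h} {suc y} (nf2 _ e≤c nt) l with c ≟ₒ e
... | yes refl = tail< (run<ₒωmul nt (≤-pred l))
... | no c≢e = tail< (ω^+<ₒωmul (strict e≤c) (≤-pred l))
  where
    strict : e ≤ₒ c → e <ₒ c
    strict (inj₁ e<c) = e<c
    strict (inj₂ e≡c) = ⊥-elim (c≢e (sym e≡c))

isSucc-tail : ∀ b e f → isSucc (ω^ e + f) ≡ true → isSucc (ω^ b + (ω^ e + f)) ≡ true
isSucc-tail zer e f s = s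
isSucc-tail (ω^ _ + _) e f s = s

-- The successor alternative is what rules out γ = β[y] below a limit exponent,
-- where β[y] = ω^(E[y]) would otherwise not dominate ω^(E[y]) + g.
<ₒ⇒<ₒ[]⊎≡[] : ∀ {β γ y} → NF β → NF γ → γ <ₒ β → CoeffsBelow y γ → 0 < y
  → (γ <ₒ (β [ y ])) ⊎ ((γ ≡ (β [ y ])) × (isSucc β ≡ true))
<ₒ⇒<ₒ[]⊎≡[] {ω^ b + (ω^ e + f)} _ _ z<ω _ _ = inj₁ z<ω
<ₒ⇒<ₒ[]⊎≡[] {ω^ zer + zer} _ _ z<ω _ _ = inj₂ (refl , refl)
<ₒ⇒<ₒ[]⊎≡[] {ω^ (ω^ e + f) + zer} _ _ z<ω _ (s≤s z≤n) with isSucc (ω^ e + f)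
... | true = inj₁ z<ω
... | false = inj₁ z<ω
<ₒ⇒<ₒ[]⊎≡[] {ω^ b + (ω^ e + f)} _ _ (exp< p) _ _ = inj₁ (exp< p)
<ₒ⇒<ₒ[]⊎≡[] {ω^ zer + zer} _ _ (exp< ()) _ _
<ₒ⇒<ₒ[]⊎≡[] {ω^ (ω^ e + f) + zer} {ω^ c + g} {suc y} (nf1 nE) nγ (exp< c<E) (ω^ bc + _ ∣ l) y>0
  with isSucc (ω^ e + f) | <ₒ⇒<ₒ[]⊎≡[] nE (NF-exponent nγ) c<E bc y>0
... | true | inj₁ q = inj₁ (exp< q)
... | true | inj₂ (refl , _) = inj₁ (run<ₒωmul nγ l)
... | false | inj₁ q = inj₁ (exp< q)
... | false | inj₂ (_ , ())
<ₒ⇒<ₒ[]⊎≡[] {ω^ b + (ω^ e + f)} nβ nγ (tail< p) (ω^ _ + bg ∣ _) y>0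
  with <ₒ⇒<ₒ[]⊎≡[] (NF-tail nβ) (NF-tail nγ) p bg y>0
... | inj₁ q = inj₁ (tail< q)
... | inj₂ (q , s) = inj₂ (cong (ω^ b +_) q , isSucc-tail b e f s)
<ₒ⇒<ₒ[]⊎≡[] {ω^ b + zer} _ _ (tail< ()) _ _

[]-mono : ∀ a b x y → NF a → NF b → a ≤ₒ b → x ≤ y → CoeffsBelow y a → 0 < y
  → (a [ x ]) ≤ₒ (b [ y ])
[]-mono a b x y na nb (inj₂ refl) x≤y _ _ = []-monoʳ a na x≤y
[]-mono a b x y na nb (inj₁ a<b) x≤y ba y>0 with <ₒ⇒<ₒ[]⊎≡[] nb na a<b ba y>0
... | inj₁ q = ≤ₒ-trans ([]≤ₒ a x na) (inj₁ q)
... | inj₂ (q , _) = ≤ₒ-trans ([]≤ₒ a x na) (inj₂ q)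

iterFS-positive-mono : ∀ n a b → NF a → NF b → a ≤ₒ b → (x y : Fin n → ℕ)
  → (∀ i j → i <ᶠ j → y i < y j) → (∀ i → CoeffsBelow (y i) a) → (∀ i → 0 < y i)
  → (∀ i → x i ≤ y i) → zer <ₒ iterFS a n x → zer <ₒ iterFS b n y
iterFS-positive-mono zero a b _ _ a≤b x y _ _ _ _ pos = <ₒ-≤ₒ-trans pos a≤b
iterFS-positive-mono (suc n) a b na nb a≤b x y y-inc ba y>0 x≤y pos =
  iterFS-positive-mono n (a [ x fzero ]) (b [ y fzero ]) (NF-[] a _ na) (NF-[] b _ nb)
    ([]-mono a b (x fzero) (y fzero) na nb a≤b (x≤y fzero) (ba fzero) (y>0 fzero))
    (λ i → x (fsuc i)) (λ i → y (fsuc i)) (λ i j i<j → y-inc (fsuc i) (fsuc j) (s≤s i<j))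
    coeffsBelow-next (λ i → y>0 (fsuc i)) (λ i → x≤y (fsuc i)) pos
  where
    coeffsBelow-next : ∀ i → CoeffsBelow (y (fsuc i)) (a [ x fzero ])
    coeffsBelow-next i =
      coeffsBelow-[] a (x fzero) na (coeffsBelow-mono (<⇒≤ y₀<y) (ba fzero))
        (≤-<-trans (x≤y fzero) y₀<y)
      where y₀<y = y-inc fzero (fsuc i) (s≤s z≤n)

lemma2 : (α : T) → NF α → (R : ℕ) → (x y : Fin (suc R) → ℕ)
    → (∀ i j → i <ᶠ j → x i < x j)
    → (∀ i j → i <ᶠ j → y i < y j)
    → MC α < y fzero
    → (∀ i → 0 < x i)
    → (∀ i → x i ≤ y i)
    → zer <ₒ iterFS α (suc R) x
    → zer <ₒ iterFS α (suc R) y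
lemma2 α nα R x y _ y-inc mc _ x≤y =
  iterFS-positive-mono (suc R) α α nα nα (inj₂ refl) x y y-inc
    (λ i → coeffsBelow-mono (y₀≤ i) (MC<⇒coeffsBelow α mc)) y>0 x≤y
  where
    y₀≤ : ∀ i → y fzero ≤ y i
    y₀≤ fzero = ≤-refl
    y₀≤ (fsuc i) = <⇒≤ (y-inc fzero (fsuc i) (s≤s z≤n))
    y>0 : ∀ i → 0 < y i
    y>0 i = <-≤-trans (≤-<-trans z≤n mc) (y₀≤ i)
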